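{- Let $n$ be a positive integer with $\gcd(n,6)=1$, and let $(1)(a)(b)(c)$, where $c=2n-1-a-b$ and $1\le a,b,c\le n-1$ are integers, be a minimal zero-sum sequence modulo $n$ whose index is $2$. Then at least one of the pairs $(x,y)\in\{(1,a),(1,b),(a,b)\}$ satisfies none of the relations $x+3y\equiv 0$, $x-3y\equiv 0$, $3x+y\equiv 0$, $3x-y\equiv 0\pmod n$.
   Context: A sequence $(a_1)\cdots(a_k)$ over $\mathbb{Z}/n$ (elements identified with integers, here with $1\le a_j\le n$) is zero-sum if $\sum_j a_j\equiv 0\pmod n$, and minimal zero-sum if it is zero-sum but no proper nontrivial subsequence is zero-sum. For an integer $x$, $(x)_n$ is the least non-negative integer congruent to $x$ modulo $n$. The index of $S=(a_1)\cdots(a_k)$ is $\min\left\{\frac1n\sum_{j=1}^k(ga_j)_n : g\in(\mathbb{Z}/n)^*\right\}$. -}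

module Defs where

open import Data.Nat using (ℕ; _+_; _*_; _≤_; _<_; NonZero)
open import Data.Nat.DivMod using (_%_)
open import Data.Nat.GCD using (gcd)
open import Data.List using (List; []; map; length)
open import Data.Nat.ListAction using (sum)
open import Data.List.Relation.Binary.Sublist.Propositional using (_⊆_)
open import Data.Product using (Σ; _×_; ∃)
open import Data.Sum using (_⊎_)
open import Relation.Binary.PropositionalEquality using (_≡_; _≢_)
open import Relation.Nullary using (¬_)

-- Sequences over ℤ/n are lists of integer representatives (naturals).
-- A sequence is zero-sum mod n if the sum of its terms is ≡ 0 mod n.
ZeroSum : (n : ℕ) .{{_ : NonZero n}} → List ℕ → Set
ZeroSum n S = sum S % n ≡ 0

MinimalZeroSum : (n : ℕ) .{{_ : NonZero n}} → List ℕ → Set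
MinimalZeroSum n S =
  ZeroSum n S ×
  (∀ (T : List ℕ) → T ⊆ S → T ≢ [] → length T < length S → ¬ ZeroSum n T)

IsUnit : (n : ℕ) → ℕ → Set
IsUnit n g = g < n × gcd g n ≡ 1

weightedSum : (n : ℕ) .{{_ : NonZero n}} → ℕ → List ℕ → ℕ
weightedSum n g S = sum (map (λ a → (g * a) % n) S)

-- index(S) = k, i.e. min { (1/n) Σ_j (g a_j)_n : g unit } = k,
-- written as: the minimum of the sums Σ_j (g a_j)_n over units g equals k * n.
HasIndex : (n : ℕ) .{{_ : NonZero n}} → List ℕ → ℕ → Set
HasIndex n S k =
  (Σ ℕ λ g → IsUnit n g × weightedSum n g S ≡ k * n) ×
  (∀ g → IsUnit n g → k * n ≤ weightedSum n g S)

SomeRelation : (n : ℕ) .{{_ : NonZero n}} → ℕ → ℕ → Set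
SomeRelation n x y =
  ((x + 3 * y) % n ≡ 0) ⊎
  (x % n ≡ (3 * y) % n) ⊎
  ((3 * x + y) % n ≡ 0) ⊎
  ((3 * x) % n ≡ y % n)

-- Each relation reads α x + β y ≡ 0 (mod n) with {|α|, |β|} = {1, 3}. If all three pairs
-- satisfy one, eliminating a and b from the relations for (1, a), (1, b) and (a, b) shows that
-- n divides the resultant α₁β₂α₃ + α₂β₁β₃, which is one of ±6, ±12, ±26, ±28. As n is prime
-- to 6, n is 1, 7 or 13; n = 1 leaves no room for a, and for n = 7 and 13 a search finds, for
-- every admissible a and b, a unit g with Σ (g aⱼ)ₙ < 2n, contradicting index 2.

module Submission where

open import Defs
open import Data.List using (List; _∷_; [])
open import Data.Product using (∃; _×_; _,_)
open import Data.Sum using (_⊎_; inj₁; inj₂)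
open import Relation.Binary.PropositionalEquality
  using (_≡_; refl; sym; trans; cong; cong₂; subst; module ≡-Reasoning)
open import Relation.Nullary using (¬_; contradiction)
open import Relation.Nullary.Decidable
  using (Dec; yes; no; map′; ¬?; _⊎-dec_; _×-dec_; _→-dec_; toWitness)

open import Data.Nat using (ℕ; _+_; _*_; _≤_; _∸_; NonZero; _<_; s≤s; _≟_; _<?_)
open import Data.Nat.Properties using (≤-trans; <⇒≱; m+n∸n≡m; allUpTo?; anyUpTo?)
open import Data.Nat.Tactic.RingSolver as ℕ-Solver using ()
open import Data.Nat.DivMod using (_%_; _/_; m≡m%n+[m/n]*n)
open import Data.Nat.Divisibility as ℕ using (m%n≡0⇒n∣m; ∣⇒≤; _∣?_)
open import Data.Nat.GCD using (gcd)
open import Data.Nat.Coprimality using (gcd≡1⇒coprime)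

open import Data.Integer as ℤ using (ℤ; +_; -_; 1ℤ; ∣_∣)
open import Data.Integer.Properties using (pos-+; pos-*; *-identityˡ; *-identityʳ; neg-distribˡ-*)
open import Data.Integer.Divisibility.Signed
  using (_∣_; divides; ∣ᵤ⇒∣; ∣⇒∣ᵤ; ∣n⇒∣m*n; ∣m∣n⇒∣m+n; ∣m∣n⇒∣m-n)
open import Data.Integer.Tactic.RingSolver using (solve-∀)

+-divMod : ∀ m n .{{_ : NonZero n}} → + m ≡ + (m % n) ℤ.+ + (m / n) ℤ.* + n
+-divMod m n = trans (cong +_ (m≡m%n+[m/n]*n m n))
                     (trans (pos-+ (m % n) _) (cong (ℤ._+_ (+ (m % n))) (pos-* (m / n) n)))

%≡0⇒∣ : ∀ m n .{{_ : NonZero n}} → m % n ≡ 0 → + n ∣ + m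
%≡0⇒∣ m n m%n≡0 = ∣ᵤ⇒∣ (m%n≡0⇒n∣m m n m%n≡0)

%≡%⇒∣- : ∀ m o n .{{_ : NonZero n}} → m % n ≡ o % n → + n ∣ + m ℤ.- + o
%≡%⇒∣- m o n m%n≡o%n = divides (+ (m / n) ℤ.- + (o / n)) (begin
  + m ℤ.- + o
    ≡⟨ cong₂ ℤ._-_ (+-divMod m n) (+-divMod o n) ⟩
  (+ (m % n) ℤ.+ + (m / n) ℤ.* + n) ℤ.- (+ (o % n) ℤ.+ + (o / n) ℤ.* + n)
    ≡⟨ cong (λ r → (+ r ℤ.+ + (m / n) ℤ.* + n) ℤ.- (+ (o % n) ℤ.+ + (o / n) ℤ.* + n)) m%n≡o%n ⟩
  (+ (o % n) ℤ.+ + (m / n) ℤ.* + n) ℤ.- (+ (o % n) ℤ.+ + (o / n) ℤ.* + n)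
    ≡⟨ cancel (+ (o % n)) (+ (m / n)) (+ (o / n)) (+ n) ⟩
  (+ (m / n) ℤ.- + (o / n)) ℤ.* + n ∎)
  where
  open ≡-Reasoning
  cancel : ∀ r q₁ q₂ k → (r ℤ.+ q₁ ℤ.* k) ℤ.- (r ℤ.+ q₂ ℤ.* k) ≡ (q₁ ℤ.- q₂) ℤ.* k
  cancel = solve-∀

data Relation : Set where
  x+3y x-3y 3x+y 3x-y : Relation

coeffˣ coeffʸ : Relation → ℤ
coeffˣ x+3y = 1ℤ
coeffˣ x-3y = 1ℤ
coeffˣ 3x+y = + 3
coeffˣ 3x-y = + 3
coeffʸ x+3y = + 3
coeffʸ x-3y = - + 3
coeffʸ 3x+y = 1ℤ
coeffʸ 3x-y = - 1ℤ

form : Relation → ℤ → ℤ → ℤ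
form r x y = coeffˣ r ℤ.* x ℤ.+ coeffʸ r ℤ.* y

all? : {P : Relation → Set} → (∀ r → Dec (P r)) → Dec (∀ r → P r)
all? P? = map′ (λ (p , q , s , t) → λ { x+3y → p ; x-3y → q ; 3x+y → s ; 3x-y → t })
               (λ ∀P → ∀P x+3y , ∀P x-3y , ∀P 3x+y , ∀P 3x-y)
               (P? x+3y ×-dec P? x-3y ×-dec P? 3x+y ×-dec P? 3x-y)

someRelation⇒∣form : ∀ {n} .{{_ : NonZero n}} x y → SomeRelation n x y →
                     ∃ λ r → + n ∣ form r (+ x) (+ y)
someRelation⇒∣form {n} x y (inj₁ ≡0) = x+3y , subst (+ n ∣_)
  (trans (pos-+ x (3 * y)) (cong₂ ℤ._+_ (sym (*-identityˡ (+ x))) (pos-* 3 y)))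
  (%≡0⇒∣ _ n ≡0)
someRelation⇒∣form {n} x y (inj₂ (inj₁ ≡%)) = x-3y , subst (+ n ∣_)
  (cong₂ ℤ._+_ (sym (*-identityˡ (+ x))) (trans (cong -_ (pos-* 3 y)) (neg-distribˡ-* (+ 3) (+ y))))
  (%≡%⇒∣- x (3 * y) n ≡%)
someRelation⇒∣form {n} x y (inj₂ (inj₂ (inj₁ ≡0))) = 3x+y , subst (+ n ∣_)
  (trans (pos-+ (3 * x) y) (cong₂ ℤ._+_ (pos-* 3 x) (sym (*-identityˡ (+ y)))))
  (%≡0⇒∣ _ n ≡0)
someRelation⇒∣form {n} x y (inj₂ (inj₂ (inj₂ ≡%))) = 3x-y , subst (+ n ∣_)
  (cong₂ ℤ._+_ (pos-* 3 x) (trans (cong -_ (sym (*-identityˡ (+ y)))) (neg-distribˡ-* 1ℤ (+ y))))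
  (%≡%⇒∣- (3 * x) y n ≡%)

someRelation? : ∀ n .{{_ : NonZero n}} x y → Dec (SomeRelation n x y)
someRelation? n x y = ((x + 3 * y) % n ≟ 0) ⊎-dec (x % n ≟ (3 * y) % n) ⊎-dec
                      ((3 * x + y) % n ≟ 0) ⊎-dec ((3 * x) % n ≟ y % n)

∣-eliminate : ∀ {d} α₁ β₁ α₂ β₂ α₃ β₃ x a b →
              d ∣ α₁ ℤ.* x ℤ.+ β₁ ℤ.* a → d ∣ α₂ ℤ.* x ℤ.+ β₂ ℤ.* b → d ∣ α₃ ℤ.* a ℤ.+ β₃ ℤ.* b →
              d ∣ (α₁ ℤ.* β₂ ℤ.* α₃ ℤ.+ α₂ ℤ.* β₁ ℤ.* β₃) ℤ.* x
∣-eliminate {d} α₁ β₁ α₂ β₂ α₃ β₃ x a b d∣xa d∣xb d∣ab =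
  subst (d ∣_) (sym (combination α₁ β₁ α₂ β₂ α₃ β₃ x a b))
    (∣m∣n⇒∣m-n (∣m∣n⇒∣m+n (∣n⇒∣m*n (α₃ ℤ.* β₂) d∣xa) (∣n⇒∣m*n (β₃ ℤ.* β₁) d∣xb))
               (∣n⇒∣m*n (β₁ ℤ.* β₂) d∣ab))
  where
  combination : ∀ α₁ β₁ α₂ β₂ α₃ β₃ x a b →
    (α₁ ℤ.* β₂ ℤ.* α₃ ℤ.+ α₂ ℤ.* β₁ ℤ.* β₃) ℤ.* x
      ≡ (α₃ ℤ.* β₂) ℤ.* (α₁ ℤ.* x ℤ.+ β₁ ℤ.* a) ℤ.+ (β₃ ℤ.* β₁) ℤ.* (α₂ ℤ.* x ℤ.+ β₂ ℤ.* b)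
        ℤ.- (β₁ ℤ.* β₂) ℤ.* (α₃ ℤ.* a ℤ.+ β₃ ℤ.* b)
  combination = solve-∀

resultant : Relation → Relation → Relation → ℤ
resultant r₁ r₂ r₃ = coeffˣ r₁ ℤ.* coeffʸ r₂ ℤ.* coeffˣ r₃ ℤ.+ coeffˣ r₂ ℤ.* coeffʸ r₁ ℤ.* coeffʸ r₃

AllRelated : ∀ n .{{_ : NonZero n}} → ℕ → ℕ → Set
AllRelated n a b = SomeRelation n 1 a × SomeRelation n 1 b × SomeRelation n a b

allRelated⇒∣resultant : ∀ {n} .{{_ : NonZero n}} {a b} → AllRelated n a b →
                        ∃ λ r₁ → ∃ λ r₂ → ∃ λ r₃ → n ℕ.∣ ∣ resultant r₁ r₂ r₃ ∣
allRelated⇒∣resultant {n} {a} {b} (R₁ , R₂ , R₃)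
  with r₁ , n∣1a ← someRelation⇒∣form 1 a R₁
     | r₂ , n∣1b ← someRelation⇒∣form 1 b R₂
     | r₃ , n∣ab ← someRelation⇒∣form a b R₃
  = r₁ , r₂ , r₃ , ∣⇒∣ᵤ (subst (+ n ∣_) (*-identityʳ (resultant r₁ r₂ r₃))
      (∣-eliminate (coeffˣ r₁) (coeffʸ r₁) (coeffˣ r₂) (coeffʸ r₂) (coeffˣ r₃) (coeffʸ r₃)
                   (+ 1) (+ a) (+ b) n∣1a n∣1b n∣ab))

ResultantValue : ℕ → Set
ResultantValue m = m ≡ 6 ⊎ m ≡ 12 ⊎ m ≡ 26 ⊎ m ≡ 28

resultantValue : ∀ r₁ r₂ r₃ → ResultantValue ∣ resultant r₁ r₂ r₃ ∣
resultantValue = toWitness {a? = all? λ r₁ → all? λ r₂ → all? λ r₃ → value? ∣ resultant r₁ r₂ r₃ ∣} _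
  where
  value? : ∀ m → Dec (ResultantValue m)
  value? m = (m ≟ 6) ⊎-dec (m ≟ 12) ⊎-dec (m ≟ 26) ⊎-dec (m ≟ 28)

Exceptional : ℕ → Set
Exceptional n = n ≡ 1 ⊎ n ≡ 7 ⊎ n ≡ 13

CoprimeDivisorsExceptional : ℕ → Set
CoprimeDivisorsExceptional m = ∀ {d} → d ℕ.∣ m → ¬ 2 ℕ.∣ d → ¬ 3 ℕ.∣ d → Exceptional d

coprimeDivisorsExceptional? : ∀ m .{{_ : NonZero m}} → Dec (CoprimeDivisorsExceptional m)
coprimeDivisorsExceptional? m = map′ (λ below d∣m → below (s≤s (∣⇒≤ d∣m)) d∣m) (λ all {d} _ → all {d})
  (allUpTo? (λ d → (d ∣? m) →-dec ¬? (2 ∣? d) →-dec ¬? (3 ∣? d) →-dec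
                   ((d ≟ 1) ⊎-dec (d ≟ 7) ⊎-dec (d ≟ 13))) (1 + m))

resultantValue⇒coprimeDivisorsExceptional : ∀ {m} → ResultantValue m → CoprimeDivisorsExceptional m
resultantValue⇒coprimeDivisorsExceptional (inj₁ refl) = toWitness {a? = coprimeDivisorsExceptional? 6} _
resultantValue⇒coprimeDivisorsExceptional (inj₂ (inj₁ refl)) = toWitness {a? = coprimeDivisorsExceptional? 12} _
resultantValue⇒coprimeDivisorsExceptional (inj₂ (inj₂ (inj₁ refl))) = toWitness {a? = coprimeDivisorsExceptional? 26} _
resultantValue⇒coprimeDivisorsExceptional (inj₂ (inj₂ (inj₂ refl))) = toWitness {a? = coprimeDivisorsExceptional? 28} _

coprime-6⇒¬2∣ : ∀ {n} → gcd n 6 ≡ 1 → ¬ 2 ℕ.∣ n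
coprime-6⇒¬2∣ gcd≡1 2∣n = contradiction (gcd≡1⇒coprime gcd≡1 (2∣n , ℕ.divides 3 refl)) λ ()

coprime-6⇒¬3∣ : ∀ {n} → gcd n 6 ≡ 1 → ¬ 3 ℕ.∣ n
coprime-6⇒¬3∣ gcd≡1 3∣n = contradiction (gcd≡1⇒coprime gcd≡1 (3∣n , ℕ.divides 2 refl)) λ ()

allRelated⇒exceptional : ∀ {n} .{{_ : NonZero n}} {a b} → gcd n 6 ≡ 1 → AllRelated n a b → Exceptional n
allRelated⇒exceptional {n} gcd≡1 related = fromResultant (allRelated⇒∣resultant related)
  where
  fromResultant : (∃ λ r₁ → ∃ λ r₂ → ∃ λ r₃ → n ℕ.∣ ∣ resultant r₁ r₂ r₃ ∣) → Exceptional n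
  fromResultant (r₁ , r₂ , r₃ , n∣R) =
    resultantValue⇒coprimeDivisorsExceptional (resultantValue r₁ r₂ r₃) n∣R
      (coprime-6⇒¬2∣ gcd≡1) (coprime-6⇒¬3∣ gcd≡1)

LowWeightUnit : ∀ n .{{_ : NonZero n}} → List ℕ → Set
LowWeightUnit n S = ∃ λ g → g < n × gcd g n ≡ 1 × weightedSum n g S < 2 * n

lowWeightUnit⇒¬index2 : ∀ {n} .{{_ : NonZero n}} {S} → LowWeightUnit n S → ¬ HasIndex n S 2
lowWeightUnit⇒¬index2 (g , g<n , coprime , small) (_ , minimal) = <⇒≱ small (minimal g (g<n , coprime))

RelatedHaveLowWeightUnit : ∀ n .{{_ : NonZero n}} → Set
RelatedHaveLowWeightUnit n = ∀ {a} → a < n → ∀ {b} → b < n → AllRelated n a b →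
                             LowWeightUnit n (1 ∷ a ∷ b ∷ 2 * n ∸ (1 + a + b) ∷ [])

relatedHaveLowWeightUnit? : ∀ n .{{_ : NonZero n}} → Dec (RelatedHaveLowWeightUnit n)
relatedHaveLowWeightUnit? n = allUpTo? (λ a → allUpTo? (λ b →
    (someRelation? n 1 a ×-dec someRelation? n 1 b ×-dec someRelation? n a b) →-dec
    anyUpTo? (λ g → (gcd g n ≟ 1) ×-dec (weightedSum n g (1 ∷ a ∷ b ∷ 2 * n ∸ (1 + a + b) ∷ []) <? 2 * n)) n) n) n

relatedHaveLowWeightUnit-7 : RelatedHaveLowWeightUnit 7
relatedHaveLowWeightUnit-7 = toWitness {a? = relatedHaveLowWeightUnit? 7} _

relatedHaveLowWeightUnit-13 : RelatedHaveLowWeightUnit 13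
relatedHaveLowWeightUnit-13 = toWitness {a? = relatedHaveLowWeightUnit? 13} _

sum≡⇒c≡ : ∀ {n a b c} → c + a + b + 1 ≡ 2 * n → c ≡ 2 * n ∸ (1 + a + b)
sum≡⇒c≡ {n} {a} {b} {c} sum =
  trans (sym (m+n∸n≡m c (1 + a + b))) (cong (_∸ (1 + a + b)) (trans (regroup c a b) sum))
  where
  regroup : ∀ c a b → c + (1 + a + b) ≡ c + a + b + 1
  regroup = ℕ-Solver.solve-∀

lowWeightUnits⇒¬allRelated : ∀ {n} .{{_ : NonZero n}} {a b c} → RelatedHaveLowWeightUnit n →
                             a < n → b < n → c + a + b + 1 ≡ 2 * n →
                             HasIndex n (1 ∷ a ∷ b ∷ c ∷ []) 2 → ¬ AllRelated n a b
lowWeightUnits⇒¬allRelated {n} {a} {b} {c} lowWeightUnits a<n b<n sum index2 related =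
  lowWeightUnit⇒¬index2 {S = 1 ∷ a ∷ b ∷ c ∷ []}
    (subst (λ c → LowWeightUnit n (1 ∷ a ∷ b ∷ c ∷ [])) (sym (sum≡⇒c≡ {n} sum)) (lowWeightUnits a<n b<n related))
    index2

exceptional⇒¬allRelated : ∀ {n} .{{_ : NonZero n}} {a b c} → Exceptional n → c + a + b + 1 ≡ 2 * n →
                          1 ≤ a → a ≤ n ∸ 1 → b ≤ n ∸ 1 → HasIndex n (1 ∷ a ∷ b ∷ c ∷ []) 2 → ¬ AllRelated n a b
exceptional⇒¬allRelated (inj₁ refl) _ 1≤a a≤0 _ _ _ = contradiction (≤-trans 1≤a a≤0) λ ()
exceptional⇒¬allRelated (inj₂ (inj₁ refl)) sum _ a≤6 b≤6 =
  lowWeightUnits⇒¬allRelated relatedHaveLowWeightUnit-7 (s≤s a≤6) (s≤s b≤6) sum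
exceptional⇒¬allRelated (inj₂ (inj₂ refl)) sum _ a≤12 b≤12 =
  lowWeightUnits⇒¬allRelated relatedHaveLowWeightUnit-13 (s≤s a≤12) (s≤s b≤12) sum

lemma6 : (n : ℕ) .{{_ : NonZero n}} → gcd n 6 ≡ 1 →
    (a b c : ℕ) → c + a + b + 1 ≡ 2 * n →
    1 ≤ a → a ≤ n ∸ 1 → 1 ≤ b → b ≤ n ∸ 1 → 1 ≤ c → c ≤ n ∸ 1 →
    MinimalZeroSum n (1 ∷ a ∷ b ∷ c ∷ []) →
    HasIndex n (1 ∷ a ∷ b ∷ c ∷ []) 2 →
    ¬ SomeRelation n 1 a ⊎ ¬ SomeRelation n 1 b ⊎ ¬ SomeRelation n a b
lemma6 n gcd≡1 a b c sum 1≤a a≤n-1 _ b≤n-1 _ _ _ index2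
  with someRelation? n 1 a | someRelation? n 1 b | someRelation? n a b
... | no ¬R₁ | _      | _      = inj₁ ¬R₁
... | yes _  | no ¬R₂ | _      = inj₂ (inj₁ ¬R₂)
... | yes _  | yes _  | no ¬R₃ = inj₂ (inj₂ ¬R₃)
... | yes R₁ | yes R₂ | yes R₃ =
  contradiction related
    (exceptional⇒¬allRelated (allRelated⇒exceptional gcd≡1 related) sum 1≤a a≤n-1 b≤n-1 index2)
  where
  related : AllRelated n a b
  related = R₁ , R₂ , R₃
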